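{- For every integer $m\ge 2$, as formal power series in $q$, $$\sum_{n=1}^\infty \frac{q^n\left(1-q^{(m-1)n}\right)(q^{mn};q^m)_\infty}{(1-q^n)\,(q^{n+1};q)_{(m-1)n}\,(q^{mn};q)_\infty} = -1 + \frac{(q^m;q^m)_\infty}{(q;q)_\infty}.$$
   Context: Standard $q$-Pochhammer notation: $(a;q)_n=(1-a)(1-aq)\cdots(1-aq^{n-1})$ and $(a;q)_\infty=\prod_{k=0}^\infty(1-aq^k)$. -}

module Defs where

open import Data.Nat using (ℕ; zero; suc; _∸_; _≟_) renaming (_+_ to _+ℕ_; _*_ to _*ℕ_)
open import Data.Integer using (ℤ; +_; _+_; _*_; -_)
open import Data.List using (List; []; _∷_; map; upTo; foldr; zipWith)
open import Relation.Nullary using (yes; no)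
open import Relation.Binary.PropositionalEquality using (_≡_)

sum : List ℤ → ℤ
sum = foldr _+_ (+ 0)

FPS : Set
FPS = ℕ → ℤ

infix 4 _≐_
_≐_ : FPS → FPS → Set
f ≐ g = ∀ N → f N ≡ g N

const : ℤ → FPS
const c zero    = c
const c (suc _) = + 0

qpow : ℕ → FPS
qpow k N with N ≟ k
... | yes _ = + 1
... | no  _ = + 0

infixl 6 _⊕_ _⊖_
infixl 7 _⊛_

_⊕_ : FPS → FPS → FPS
(f ⊕ g) N = f N + g N

_⊖_ : FPS → FPS → FPS
(f ⊖ g) N = f N + - g N

_⊛_ : FPS → FPS → FPS
(f ⊛ g) N = sum (map (λ i → f i * g (N ∸ i)) (upTo (suc N)))

-- Multiplicative inverse of a series with constant term 1:
-- g 0 = 1, g N = - Σ_{i=1}^{N} f i * g (N - i).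
-- invRev f N = [g N, g (N-1), ..., g 0].
invRev : FPS → ℕ → List ℤ
invRev f zero    = + 1 ∷ []
invRev f (suc N) = (- sum (zipWith _*_ (map (λ i → f (suc i)) (upTo (suc N))) prev)) ∷ prev
  where prev = invRev f N

headℤ : List ℤ → ℤ
headℤ []      = + 0
headℤ (x ∷ _) = x

-- inverse (only meaningful for series with constant term 1)
inv : FPS → FPS
inv f N = headℤ (invRev f N)

prodL : List FPS → FPS
prodL = foldr _⊛_ (const (+ 1))

poch : ℕ → ℕ → ℕ → FPS
poch s b len = prodL (map (λ k → const (+ 1) ⊖ qpow (s +ℕ b *ℕ k)) (upTo len))

-- infinite q-Pochhammer (q^s ; q^b)_∞ = ∏_{k≥0} (1 - q^{s + b k}).
-- For s ≥ 1, b ≥ 1 every factor with k ≥ N+1 is ≡ 1 mod q^{N+1},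
-- so the coefficient of q^N equals that of the partial product over k ≤ N.
poch∞ : ℕ → ℕ → FPS
poch∞ s b N = poch s b (suc N) N

-- Σ_{n≥1} T n, for a family with T n ≡ 0 mod q^n (order ≥ n):
-- the coefficient of q^N only involves n = 1..N.
sumFrom1 : (ℕ → FPS) → FPS
sumFrom1 T N = sum (map (λ i → T (suc i) N) (upTo N))

summand : ℕ → ℕ → FPS
summand m n =
  qpow n ⊛ (const (+ 1) ⊖ qpow ((m ∸ 1) *ℕ n)) ⊛ poch∞ (m *ℕ n) m
    ⊛ inv ((const (+ 1) ⊖ qpow n) ⊛ poch (suc n) 1 ((m ∸ 1) *ℕ n) ⊛ poch∞ (m *ℕ n) 1)

-- Write E = (q;q)_∞, Q k = (q;q)_k and P n = (q^{mn};q^m)_∞. Since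
-- (q;q)_{n-1} (1-q^n) (q^{n+1};q)_{(m-1)n} (q^{mn};q)_∞ = (1-q^{mn}) E and
-- P n = (1-q^{mn}) P (n+1), the n-th summand times E equals
-- Q (n-1) (q^n - q^{mn}) P (n+1) = Q (n-1) P n - Q n P (n+1).
-- Hence the first N summands times E telescope to P 1 - Q N P (N+1), and
-- Q N P (N+1) ≡ E modulo q^(N+1), so the coefficient of q^N of the sum is
-- that of P 1 / E - 1.

module Submission where

open import Algebra.Bundles using (CommutativeRing)
import Algebra.Solver.Ring as RingSolver
open import Algebra.Solver.Ring.AlmostCommutativeRing
  using (fromCommutativeRing; _-Raw-AlmostCommutative⟶_)
open import Data.Empty using (⊥-elim)
open import Data.Integer using (ℤ; +_; -[1+_]; _+_; _*_; -_)
import Data.Integer as ℤ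
import Data.Integer.Properties as ℤ
open import Data.Integer.Tactic.RingSolver using (solve-∀)
open import Data.List using (_∷_; map; upTo; zipWith; applyUpTo; applyDownFrom)
open import Data.List.Properties using (map-applyUpTo)
import Data.Maybe as Maybe
open import Data.Nat using (ℕ; zero; suc; _≤_; _<_; _∸_; z≤n; s≤s; _≟_)
  renaming (_+_ to _+ℕ_; _*_ to _*ℕ_)
import Data.Nat.Properties as ℕ
open import Data.Product using (_,_)
open import Function using (_∘_; id)
open import Relation.Binary.PropositionalEquality
open import Relation.Nullary using (yes; no)
open import Relation.Nullary.Decidable using (dec⇒maybe)
import Relation.Binary.Reasoning.Setoid

open import Defs

tail : FPS → FPS
tail f N = f (suc N)

infixr 7 _·_
_·_ : ℤ → FPS → FPS
(c · f) N = c * f N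

⊛-coeff₀ : ∀ f g → (f ⊛ g) 0 ≡ f 0 * g 0
⊛-coeff₀ f g = ℤ.+-identityʳ (f 0 * g 0)

tail-⊛ˡ : ∀ f g → tail (f ⊛ g) ≐ f 0 · tail g ⊕ tail f ⊛ g
tail-⊛ˡ f g N = cong (λ xs → h 0 + sum xs) (begin
    map h (applyUpTo suc (suc N))  ≡⟨ map-applyUpTo suc h (suc N) ⟩
    applyUpTo (h ∘ suc) (suc N)    ≡⟨ map-applyUpTo id (h ∘ suc) (suc N) ⟨
    map (h ∘ suc) (upTo (suc N))   ∎)
  where
  open ≡-Reasoning
  h : ℕ → ℤ
  h i = f i * g (suc N ∸ i)

-- Agreement modulo q^(c+1).
infix 4 _≐[_]_
_≐[_]_ : FPS → ℕ → FPS → Set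
f ≐[ c ] g = ∀ j → j ≤ c → f j ≡ g j

⊛-coeff-cong : ∀ {f f′ g g′} j → f ≐[ j ] f′ → g ≐[ j ] g′ → (f ⊛ g) j ≡ (f′ ⊛ g′) j
⊛-coeff-cong {f} {f′} {g} {g′} zero f≐ g≐ = begin
    (f ⊛ g) 0      ≡⟨ ⊛-coeff₀ f g ⟩
    f 0 * g 0      ≡⟨ cong₂ _*_ (f≐ 0 z≤n) (g≐ 0 z≤n) ⟩
    f′ 0 * g′ 0    ≡⟨ ⊛-coeff₀ f′ g′ ⟨
    (f′ ⊛ g′) 0    ∎
  where open ≡-Reasoning
⊛-coeff-cong {f} {f′} {g} {g′} (suc j) f≐ g≐ = begin
    (f ⊛ g) (suc j)                        ≡⟨ tail-⊛ˡ f g j ⟩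
    f 0 * g (suc j) + (tail f ⊛ g) j       ≡⟨ cong₂ _+_ (cong₂ _*_ (f≐ 0 z≤n) (g≐ (suc j) ℕ.≤-refl))
                                                         (⊛-coeff-cong j tail-f≐ g≐′) ⟩
    f′ 0 * g′ (suc j) + (tail f′ ⊛ g′) j   ≡⟨ tail-⊛ˡ f′ g′ j ⟨
    (f′ ⊛ g′) (suc j)                      ∎
  where
  open ≡-Reasoning
  tail-f≐ : tail f ≐[ j ] tail f′
  tail-f≐ i i≤j = f≐ (suc i) (s≤s i≤j)
  g≐′ : g ≐[ j ] g′
  g≐′ i i≤j = g≐ i (ℕ.m≤n⇒m≤1+n i≤j)

⊛-cong-mod : ∀ {c f f′ g g′} → f ≐[ c ] f′ → g ≐[ c ] g′ → f ⊛ g ≐[ c ] f′ ⊛ g′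
⊛-cong-mod f≐ g≐ j j≤c =
  ⊛-coeff-cong j (λ i i≤j → f≐ i (ℕ.≤-trans i≤j j≤c)) (λ i i≤j → g≐ i (ℕ.≤-trans i≤j j≤c))

⊛-cong : ∀ {f f′ g g′} → f ≐ f′ → g ≐ g′ → f ⊛ g ≐ f′ ⊛ g′
⊛-cong f≐ g≐ N = ⊛-coeff-cong N (λ i _ → f≐ i) (λ i _ → g≐ i)

⊕-cong : ∀ {f f′ g g′} → f ≐ f′ → g ≐ g′ → f ⊕ g ≐ f′ ⊕ g′
⊕-cong f≐ g≐ N = cong₂ _+_ (f≐ N) (g≐ N)

⊖-cong : ∀ {f f′ g g′} → f ≐ f′ → g ≐ g′ → f ⊖ g ≐ f′ ⊖ g′
⊖-cong f≐ g≐ N = cong₂ (λ a b → a + - b) (f≐ N) (g≐ N)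

⊛-congˡ : ∀ f {g g′} → g ≐ g′ → f ⊛ g ≐ f ⊛ g′
⊛-congˡ f = ⊛-cong {f} {f} (λ _ → refl)

⊛-congʳ : ∀ h {f f′} → f ≐ f′ → f ⊛ h ≐ f′ ⊛ h
⊛-congʳ h f≐f′ = ⊛-cong {g = h} {g′ = h} f≐f′ (λ _ → refl)

0ₛ 1ₛ : FPS
0ₛ _ = + 0
1ₛ = const (+ 1)

negate : FPS → FPS
negate f N = - f N

⊛-zeroˡ : ∀ f → 0ₛ ⊛ f ≐ 0ₛ
⊛-zeroˡ f zero    = trans (⊛-coeff₀ 0ₛ f) (ℤ.*-zeroˡ (f 0))
⊛-zeroˡ f (suc N) = trans (tail-⊛ˡ 0ₛ f N) (cong₂ _+_ (ℤ.*-zeroˡ (f (suc N))) (⊛-zeroˡ f N))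

⊛-identityˡ : ∀ f → 1ₛ ⊛ f ≐ f
⊛-identityˡ f zero    = trans (⊛-coeff₀ 1ₛ f) (ℤ.*-identityˡ (f 0))
⊛-identityˡ f (suc N) = begin
    (1ₛ ⊛ f) (suc N)                  ≡⟨ tail-⊛ˡ 1ₛ f N ⟩
    + 1 * f (suc N) + (0ₛ ⊛ f) N      ≡⟨ cong₂ _+_ (ℤ.*-identityˡ (f (suc N))) (⊛-zeroˡ f N) ⟩
    f (suc N) + + 0                   ≡⟨ ℤ.+-identityʳ (f (suc N)) ⟩
    f (suc N)                         ∎
  where open ≡-Reasoning

⊛-distribʳ : ∀ f g h → (f ⊕ g) ⊛ h ≐ f ⊛ h ⊕ g ⊛ h
⊛-distribʳ f g h zero = begin
    ((f ⊕ g) ⊛ h) 0              ≡⟨ ⊛-coeff₀ (f ⊕ g) h ⟩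
    (f 0 + g 0) * h 0            ≡⟨ ℤ.*-distribʳ-+ (h 0) (f 0) (g 0) ⟩
    f 0 * h 0 + g 0 * h 0        ≡⟨ cong₂ _+_ (⊛-coeff₀ f h) (⊛-coeff₀ g h) ⟨
    (f ⊛ h) 0 + (g ⊛ h) 0        ∎
  where open ≡-Reasoning
⊛-distribʳ f g h (suc N) = begin
    ((f ⊕ g) ⊛ h) (suc N)
      ≡⟨ tail-⊛ˡ (f ⊕ g) h N ⟩
    (f 0 + g 0) * h (suc N) + ((tail f ⊕ tail g) ⊛ h) N
      ≡⟨ cong₂ _+_ (ℤ.*-distribʳ-+ (h (suc N)) (f 0) (g 0)) (⊛-distribʳ (tail f) (tail g) h N) ⟩
    (f 0 * h (suc N) + g 0 * h (suc N)) + ((tail f ⊛ h) N + (tail g ⊛ h) N)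
      ≡⟨ interchange (f 0 * h (suc N)) (g 0 * h (suc N)) ((tail f ⊛ h) N) ((tail g ⊛ h) N) ⟩
    (f 0 * h (suc N) + (tail f ⊛ h) N) + (g 0 * h (suc N) + (tail g ⊛ h) N)
      ≡⟨ cong₂ _+_ (tail-⊛ˡ f h N) (tail-⊛ˡ g h N) ⟨
    (f ⊛ h) (suc N) + (g ⊛ h) (suc N)
      ∎
  where
  open ≡-Reasoning
  interchange : ∀ a b c d → (a + b) + (c + d) ≡ (a + c) + (b + d)
  interchange = solve-∀

⊛-scaleˡ : ∀ c f h → (c · f) ⊛ h ≐ c · (f ⊛ h)
⊛-scaleˡ c f h zero = begin
    ((c · f) ⊛ h) 0     ≡⟨ ⊛-coeff₀ (c · f) h ⟩
    c * f 0 * h 0       ≡⟨ ℤ.*-assoc c (f 0) (h 0) ⟩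
    c * (f 0 * h 0)     ≡⟨ cong (c *_) (⊛-coeff₀ f h) ⟨
    c * (f ⊛ h) 0       ∎
  where open ≡-Reasoning
⊛-scaleˡ c f h (suc N) = begin
    ((c · f) ⊛ h) (suc N)                               ≡⟨ tail-⊛ˡ (c · f) h N ⟩
    c * f 0 * h (suc N) + ((c · tail f) ⊛ h) N          ≡⟨ cong₂ _+_ (ℤ.*-assoc c (f 0) (h (suc N)))
                                                                     (⊛-scaleˡ c (tail f) h N) ⟩
    c * (f 0 * h (suc N)) + c * (tail f ⊛ h) N          ≡⟨ ℤ.*-distribˡ-+ c _ _ ⟨
    c * (f 0 * h (suc N) + (tail f ⊛ h) N)              ≡⟨ cong (c *_) (tail-⊛ˡ f h N) ⟨
    c * (f ⊛ h) (suc N)                                 ∎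
  where open ≡-Reasoning

tail-⊛ʳ : ∀ f g → tail (f ⊛ g) ≐ g 0 · tail f ⊕ f ⊛ tail g
tail-⊛ʳ f g zero = begin
    (f ⊛ g) 1                       ≡⟨ tail-⊛ˡ f g 0 ⟩
    f 0 * g 1 + (tail f ⊛ g) 0      ≡⟨ cong (λ t → f 0 * g 1 + t) (⊛-coeff₀ (tail f) g) ⟩
    f 0 * g 1 + f 1 * g 0           ≡⟨ swap (f 0) (g 1) (f 1) (g 0) ⟩
    g 0 * f 1 + f 0 * g 1           ≡⟨ cong (λ t → g 0 * f 1 + t) (⊛-coeff₀ f (tail g)) ⟨
    g 0 * f 1 + (f ⊛ tail g) 0      ∎
  where
  open ≡-Reasoning
  swap : ∀ a b c d → a * b + c * d ≡ d * c + a * b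
  swap = solve-∀
tail-⊛ʳ f g (suc N) = begin
    (f ⊛ g) (suc (suc N))
      ≡⟨ tail-⊛ˡ f g (suc N) ⟩
    f 0 * g (suc (suc N)) + (tail f ⊛ g) (suc N)
      ≡⟨ cong (λ t → f 0 * g (suc (suc N)) + t) (tail-⊛ʳ (tail f) g N) ⟩
    f 0 * g (suc (suc N)) + (g 0 * f (suc (suc N)) + (tail f ⊛ tail g) N)
      ≡⟨ exchange (f 0 * g (suc (suc N))) (g 0 * f (suc (suc N))) ((tail f ⊛ tail g) N) ⟩
    g 0 * f (suc (suc N)) + (f 0 * g (suc (suc N)) + (tail f ⊛ tail g) N)
      ≡⟨ cong (λ t → g 0 * f (suc (suc N)) + t) (tail-⊛ˡ f (tail g) N) ⟨
    g 0 * f (suc (suc N)) + (f ⊛ tail g) (suc N)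
      ∎
  where
  open ≡-Reasoning
  exchange : ∀ a b c → a + (b + c) ≡ b + (a + c)
  exchange = solve-∀

⊛-comm : ∀ f g → f ⊛ g ≐ g ⊛ f
⊛-comm f g zero = begin
    (f ⊛ g) 0      ≡⟨ ⊛-coeff₀ f g ⟩
    f 0 * g 0      ≡⟨ ℤ.*-comm (f 0) (g 0) ⟩
    g 0 * f 0      ≡⟨ ⊛-coeff₀ g f ⟨
    (g ⊛ f) 0      ∎
  where open ≡-Reasoning
⊛-comm f g (suc N) = begin
    (f ⊛ g) (suc N)                     ≡⟨ tail-⊛ˡ f g N ⟩
    f 0 * g (suc N) + (tail f ⊛ g) N    ≡⟨ cong (λ t → f 0 * g (suc N) + t) (⊛-comm (tail f) g N) ⟩
    f 0 * g (suc N) + (g ⊛ tail f) N    ≡⟨ tail-⊛ʳ g f N ⟨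
    (g ⊛ f) (suc N)                     ∎
  where open ≡-Reasoning

⊛-assoc : ∀ f g h → (f ⊛ g) ⊛ h ≐ f ⊛ (g ⊛ h)
⊛-assoc f g h zero = begin
    ((f ⊛ g) ⊛ h) 0         ≡⟨ ⊛-coeff₀ (f ⊛ g) h ⟩
    (f ⊛ g) 0 * h 0         ≡⟨ cong (_* h 0) (⊛-coeff₀ f g) ⟩
    f 0 * g 0 * h 0         ≡⟨ ℤ.*-assoc (f 0) (g 0) (h 0) ⟩
    f 0 * (g 0 * h 0)       ≡⟨ cong (f 0 *_) (⊛-coeff₀ g h) ⟨
    f 0 * (g ⊛ h) 0         ≡⟨ ⊛-coeff₀ f (g ⊛ h) ⟨
    (f ⊛ (g ⊛ h)) 0         ∎
  where open ≡-Reasoning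
⊛-assoc f g h (suc N) = begin
    ((f ⊛ g) ⊛ h) (suc N)
      ≡⟨ tail-⊛ˡ (f ⊛ g) h N ⟩
    (f ⊛ g) 0 * h (suc N) + (tail (f ⊛ g) ⊛ h) N
      ≡⟨ cong₂ _+_ (cong (_* h (suc N)) (⊛-coeff₀ f g)) (⊛-congʳ h (tail-⊛ˡ f g) N) ⟩
    f 0 * g 0 * h (suc N) + ((f 0 · tail g ⊕ tail f ⊛ g) ⊛ h) N
      ≡⟨ cong (λ t → f 0 * g 0 * h (suc N) + t) (⊛-distribʳ (f 0 · tail g) (tail f ⊛ g) h N) ⟩
    f 0 * g 0 * h (suc N) + (((f 0 · tail g) ⊛ h) N + ((tail f ⊛ g) ⊛ h) N)
      ≡⟨ cong (λ t → f 0 * g 0 * h (suc N) + t) (cong₂ _+_ (⊛-scaleˡ (f 0) (tail g) h N) (⊛-assoc (tail f) g h N)) ⟩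
    f 0 * g 0 * h (suc N) + (f 0 * (tail g ⊛ h) N + (tail f ⊛ (g ⊛ h)) N)
      ≡⟨ regroup (f 0) (g 0) (h (suc N)) _ _ ⟩
    f 0 * (g 0 * h (suc N) + (tail g ⊛ h) N) + (tail f ⊛ (g ⊛ h)) N
      ≡⟨ cong (λ x → f 0 * x + (tail f ⊛ (g ⊛ h)) N) (tail-⊛ˡ g h N) ⟨
    f 0 * (g ⊛ h) (suc N) + (tail f ⊛ (g ⊛ h)) N
      ≡⟨ tail-⊛ˡ f (g ⊛ h) N ⟨
    (f ⊛ (g ⊛ h)) (suc N)
      ∎
  where
  open ≡-Reasoning
  regroup : ∀ a b c d e → a * b * c + (a * d + e) ≡ a * (b * c + d) + e
  regroup = solve-∀

FPS-commutativeRing : CommutativeRing _ _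
FPS-commutativeRing = record
  { Carrier = FPS ; _≈_ = _≐_ ; _+_ = _⊕_ ; _*_ = _⊛_ ; -_ = negate ; 0# = 0ₛ ; 1# = 1ₛ
  ; isCommutativeRing = record
    { isRing = record
      { +-isAbelianGroup = record
        { isGroup = record
          { isMonoid = record
            { isSemigroup = record
              { isMagma = record
                { isEquivalence = record
                  { refl = λ _ → refl ; sym = λ p N → sym (p N) ; trans = λ p q N → trans (p N) (q N) }
                ; ∙-cong = λ p q N → cong₂ _+_ (p N) (q N) }
              ; assoc = λ f g h N → ℤ.+-assoc (f N) (g N) (h N) }
            ; identity = (λ f N → ℤ.+-identityˡ (f N)) , (λ f N → ℤ.+-identityʳ (f N)) }
          ; inverse = (λ f N → ℤ.+-inverseˡ (f N)) , (λ f N → ℤ.+-inverseʳ (f N))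
          ; ⁻¹-cong = λ p N → cong -_ (p N) }
        ; comm = λ f g N → ℤ.+-comm (f N) (g N) }
      ; *-cong = ⊛-cong
      ; *-assoc = ⊛-assoc
      ; *-identity = ⊛-identityˡ , (λ f N → trans (⊛-comm f 1ₛ N) (⊛-identityˡ f N))
      ; distrib = (λ f g h N → trans (⊛-comm f (g ⊕ h) N)
                                     (trans (⊛-distribʳ g h f N) (cong₂ _+_ (⊛-comm g f N) (⊛-comm h f N))))
                , (λ f g h → ⊛-distribʳ g h f) }
    ; *-comm = ⊛-comm }
  }

open CommutativeRing FPS-commutativeRing
  using () renaming (refl to ≐-refl; sym to ≐-sym; trans to ≐-trans; *-identityʳ to ⊛-identityʳ)

module ≐-Reasoning = Relation.Binary.Reasoning.Setoid (CommutativeRing.setoid FPS-commutativeRing)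

≡⇒≐ : ∀ {f g} → f ≡ g → f ≐ g
≡⇒≐ refl _ = refl

const-homo : CommutativeRing.rawRing ℤ.+-*-commutativeRing
               -Raw-AlmostCommutative⟶ fromCommutativeRing FPS-commutativeRing
const-homo = record
  { ⟦_⟧    = const
  ; +-homo = λ { a b zero → refl ; a b (suc N) → refl }
  ; *-homo = const-*
  ; -‿homo = λ { a zero → refl ; a (suc N) → refl }
  ; 0-homo = λ { zero → refl ; (suc N) → refl }
  ; 1-homo = λ _ → refl
  }
  where
  const-* : ∀ a b → const (a * b) ≐ const a ⊛ const b
  const-* a b zero    = sym (⊛-coeff₀ (const a) (const b))
  const-* a b (suc N) = sym (trans (tail-⊛ˡ (const a) (const b) N)
                                   (cong₂ _+_ (ℤ.*-zeroʳ a) (⊛-zeroˡ (const b) N)))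

open RingSolver (CommutativeRing.rawRing ℤ.+-*-commutativeRing)
                (fromCommutativeRing FPS-commutativeRing) const-homo
                (λ a b → Maybe.map (≡⇒≐ ∘ cong const) (dec⇒maybe (a ℤ.≟ b)))
  using (solve; _:=_; _:+_; _:*_; _:-_; con)

-- Inverses

sum-zipWith-applyDownFrom : ∀ (a b : ℕ → ℤ) n →
  sum (zipWith _*_ (applyUpTo a n) (applyDownFrom b n)) ≡ sum (applyUpTo (λ i → a i * b (n ∸ suc i)) n)
sum-zipWith-applyDownFrom a b zero    = refl
sum-zipWith-applyDownFrom a b (suc n) = cong (λ t → a 0 * b n + t) (sum-zipWith-applyDownFrom (a ∘ suc) b n)

invRev≡applyDownFrom : ∀ f N → invRev f N ≡ applyDownFrom (inv f) (suc N)
invRev≡applyDownFrom f zero    = refl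
invRev≡applyDownFrom f (suc N) = cong (inv f (suc N) ∷_) (invRev≡applyDownFrom f N)

inv-suc : ∀ f N → inv f (suc N) ≡ - (tail f ⊛ inv f) N
inv-suc f N = cong -_ (begin
    sum (zipWith _*_ (map (tail f) (upTo (suc N))) (invRev f N))
      ≡⟨ cong₂ (λ xs ys → sum (zipWith _*_ xs ys)) (map-applyUpTo id (tail f) (suc N)) (invRev≡applyDownFrom f N) ⟩
    sum (zipWith _*_ (applyUpTo (tail f) (suc N)) (applyDownFrom (inv f) (suc N)))
      ≡⟨ sum-zipWith-applyDownFrom (tail f) (inv f) (suc N) ⟩
    sum (applyUpTo (λ i → tail f i * inv f (N ∸ i)) (suc N))
      ≡⟨ cong sum (map-applyUpTo id (λ i → tail f i * inv f (N ∸ i)) (suc N)) ⟨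
    (tail f ⊛ inv f) N
      ∎)
  where open ≡-Reasoning

⊛-inverseʳ : ∀ f → f 0 ≡ + 1 → f ⊛ inv f ≐ 1ₛ
⊛-inverseʳ f f₀≡1 zero    = trans (⊛-coeff₀ f (inv f)) (cong (_* + 1) f₀≡1)
⊛-inverseʳ f f₀≡1 (suc N) = begin
    (f ⊛ inv f) (suc N)                                  ≡⟨ tail-⊛ˡ f (inv f) N ⟩
    f 0 * inv f (suc N) + (tail f ⊛ inv f) N             ≡⟨ cong₂ (λ a b → a * b + (tail f ⊛ inv f) N) f₀≡1 (inv-suc f N) ⟩
    + 1 * - (tail f ⊛ inv f) N + (tail f ⊛ inv f) N      ≡⟨ cong (_+ (tail f ⊛ inv f) N) (ℤ.*-identityˡ (- (tail f ⊛ inv f) N)) ⟩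
    - (tail f ⊛ inv f) N + (tail f ⊛ inv f) N            ≡⟨ ℤ.+-inverseˡ ((tail f ⊛ inv f) N) ⟩
    + 0                                                  ∎
  where open ≡-Reasoning

⊛-inv-transpose : ∀ {g h} f → f 0 ≡ + 1 → g ⊛ f ≐ h → g ≐ h ⊛ inv f
⊛-inv-transpose {g} {h} f f₀≡1 g⊛f≐h = begin
    g                   ≈⟨ ⊛-identityʳ g ⟨
    g ⊛ 1ₛ              ≈⟨ ⊛-congˡ g (⊛-inverseʳ f f₀≡1) ⟨
    g ⊛ (f ⊛ inv f)     ≈⟨ ⊛-assoc g f (inv f) ⟨
    (g ⊛ f) ⊛ inv f     ≈⟨ ⊛-congʳ (inv f) g⊛f≐h ⟩
    h ⊛ inv f           ∎
  where open ≐-Reasoning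

⊛-cancelʳ : ∀ {g h} f → f 0 ≡ + 1 → g ⊛ f ≐ h ⊛ f → g ≐ h
⊛-cancelʳ {g} {h} f f₀≡1 g⊛f≐h⊛f = begin
    g                   ≈⟨ ⊛-inv-transpose f f₀≡1 g⊛f≐h⊛f ⟩
    (h ⊛ f) ⊛ inv f     ≈⟨ ⊛-inv-transpose f f₀≡1 ≐-refl ⟨
    h                   ∎
  where open ≐-Reasoning

qpow-≢ : ∀ k N → N ≢ k → qpow k N ≡ + 0
qpow-≢ k N N≢k with N ≟ k
... | yes N≡k = ⊥-elim (N≢k N≡k)
... | no  _   = refl

qpow-diag : ∀ k → qpow k k ≡ + 1
qpow-diag k with k ≟ k
... | yes _   = refl
... | no  k≢k = ⊥-elim (k≢k refl)

shift : FPS → FPS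
shift f zero    = + 0
shift f (suc N) = f N

shift-cong : ∀ {f g} → f ≐ g → shift f ≐ shift g
shift-cong f≐g zero    = refl
shift-cong f≐g (suc N) = f≐g N

shift-⊛ : ∀ f g → shift f ⊛ g ≐ shift (f ⊛ g)
shift-⊛ f g zero    = trans (⊛-coeff₀ (shift f) g) (ℤ.*-zeroˡ (g 0))
shift-⊛ f g (suc N) = trans (tail-⊛ˡ (shift f) g N) (trans (cong (_+ (f ⊛ g) N) (ℤ.*-zeroˡ (g (suc N)))) (ℤ.+-identityˡ _))

qpow-zero : qpow 0 ≐ 1ₛ
qpow-zero zero    = qpow-diag 0
qpow-zero (suc N) = qpow-≢ 0 (suc N) (λ ())

qpow-suc : ∀ k → qpow (suc k) ≐ shift (qpow k)
qpow-suc k zero = qpow-≢ (suc k) 0 (λ ())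
qpow-suc k (suc N) with N ≟ k
... | yes refl = qpow-diag (suc k)
... | no  N≢k  = qpow-≢ (suc k) (suc N) (N≢k ∘ ℕ.suc-injective)

qpow-+ : ∀ a b → qpow a ⊛ qpow b ≐ qpow (a +ℕ b)
qpow-+ zero    b = ≐-trans (⊛-congʳ (qpow b) qpow-zero) (⊛-identityˡ (qpow b))
qpow-+ (suc a) b = begin
    qpow (suc a) ⊛ qpow b      ≈⟨ ⊛-congʳ (qpow b) (qpow-suc a) ⟩
    shift (qpow a) ⊛ qpow b    ≈⟨ shift-⊛ (qpow a) (qpow b) ⟩
    shift (qpow a ⊛ qpow b)    ≈⟨ shift-cong (qpow-+ a b) ⟩
    shift (qpow (a +ℕ b))      ≈⟨ qpow-suc (a +ℕ b) ⟨
    qpow (suc a +ℕ b)          ∎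
  where open ≐-Reasoning

1-q^_ : ℕ → FPS
1-q^ e = 1ₛ ⊖ qpow e

1-q^≐[]1 : ∀ {c} e → c < e → 1-q^ e ≐[ c ] 1ₛ
1-q^≐[]1 e c<e j j≤c = trans (cong (λ t → 1ₛ j + - t) (qpow-≢ e j (ℕ.<⇒≢ (ℕ.≤-<-trans j≤c c<e))))
                           (ℤ.+-identityʳ (1ₛ j))

-- q-Pochhammer symbols

applyUpTo-cong : ∀ {A : Set} {f g : ℕ → A} → (∀ k → f k ≡ g k) → ∀ L → applyUpTo f L ≡ applyUpTo g L
applyUpTo-cong f≡g zero    = refl
applyUpTo-cong f≡g (suc L) = cong₂ _∷_ (f≡g 0) (applyUpTo-cong (f≡g ∘ suc) L)

poch-applyUpTo : ∀ s b L → poch s b L ≡ prodL (applyUpTo (λ k → 1-q^ (s +ℕ b *ℕ k)) L)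
poch-applyUpTo s b L = cong prodL (map-applyUpTo id (λ k → 1-q^ (s +ℕ b *ℕ k)) L)

poch-cons : ∀ s b L → poch s b (suc L) ≡ 1-q^ s ⊛ poch (s +ℕ b) b L
poch-cons s b L = begin
    poch s b (suc L)
      ≡⟨ poch-applyUpTo s b (suc L) ⟩
    1-q^ (s +ℕ b *ℕ 0) ⊛ prodL (applyUpTo (λ k → 1-q^ (s +ℕ b *ℕ suc k)) L)
      ≡⟨ cong₂ (λ e fs → 1-q^ e ⊛ prodL fs) s+b*0≡s (applyUpTo-cong (cong 1-q^_ ∘ exponent) L) ⟩
    1-q^ s ⊛ prodL (applyUpTo (λ k → 1-q^ (s +ℕ b +ℕ b *ℕ k)) L)
      ≡⟨ cong (1-q^ s ⊛_) (poch-applyUpTo (s +ℕ b) b L) ⟨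
    1-q^ s ⊛ poch (s +ℕ b) b L
      ∎
  where
  open ≡-Reasoning
  s+b*0≡s : s +ℕ b *ℕ 0 ≡ s
  s+b*0≡s = trans (cong (s +ℕ_) (ℕ.*-zeroʳ b)) (ℕ.+-identityʳ s)
  exponent : ∀ k → s +ℕ b *ℕ suc k ≡ s +ℕ b +ℕ b *ℕ k
  exponent k = trans (cong (s +ℕ_) (ℕ.*-suc b k)) (sym (ℕ.+-assoc s b (b *ℕ k)))

poch-+ : ∀ s b a c → poch s b (a +ℕ c) ≐ poch s b a ⊛ poch (s +ℕ b *ℕ a) b c
poch-+ s b zero c = begin
    poch s b c                     ≈⟨ ≡⇒≐ (cong (λ e → poch e b c) s+b*0≡s) ⟨
    poch (s +ℕ b *ℕ 0) b c         ≈⟨ ⊛-identityˡ _ ⟨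
    1ₛ ⊛ poch (s +ℕ b *ℕ 0) b c    ∎
  where
  open ≐-Reasoning
  s+b*0≡s : s +ℕ b *ℕ 0 ≡ s
  s+b*0≡s = trans (cong (s +ℕ_) (ℕ.*-zeroʳ b)) (ℕ.+-identityʳ s)
poch-+ s b (suc a) c = begin
    poch s b (suc a +ℕ c)
      ≈⟨ ≡⇒≐ (poch-cons s b (a +ℕ c)) ⟩
    1-q^ s ⊛ poch (s +ℕ b) b (a +ℕ c)
      ≈⟨ ⊛-congˡ (1-q^ s) (poch-+ (s +ℕ b) b a c) ⟩
    1-q^ s ⊛ (poch (s +ℕ b) b a ⊛ poch (s +ℕ b +ℕ b *ℕ a) b c)
      ≈⟨ ⊛-assoc (1-q^ s) (poch (s +ℕ b) b a) _ ⟨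
    (1-q^ s ⊛ poch (s +ℕ b) b a) ⊛ poch (s +ℕ b +ℕ b *ℕ a) b c
      ≈⟨ ⊛-cong (≡⇒≐ (sym (poch-cons s b a))) (≡⇒≐ (cong (λ e → poch e b c) exponent)) ⟩
    poch s b (suc a) ⊛ poch (s +ℕ b *ℕ suc a) b c
      ∎
  where
  open ≐-Reasoning
  exponent : s +ℕ b +ℕ b *ℕ a ≡ s +ℕ b *ℕ suc a
  exponent = trans (ℕ.+-assoc s b (b *ℕ a)) (cong (s +ℕ_) (sym (ℕ.*-suc b a)))

poch-snoc : ∀ s b L → poch s b (suc L) ≐ poch s b L ⊛ 1-q^ (s +ℕ b *ℕ L)
poch-snoc s b L = begin
    poch s b (suc L)                                 ≈⟨ ≡⇒≐ (cong (poch s b) (ℕ.+-comm 1 L)) ⟩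
    poch s b (L +ℕ 1)                                ≈⟨ poch-+ s b L 1 ⟩
    poch s b L ⊛ poch (s +ℕ b *ℕ L) b 1              ≈⟨ ⊛-congˡ (poch s b L) (≡⇒≐ (poch-cons (s +ℕ b *ℕ L) b 0)) ⟩
    poch s b L ⊛ (1-q^ (s +ℕ b *ℕ L) ⊛ 1ₛ)           ≈⟨ ⊛-congˡ (poch s b L) (⊛-identityʳ _) ⟩
    poch s b L ⊛ 1-q^ (s +ℕ b *ℕ L)                  ∎
  where open ≐-Reasoning

poch≐[]1 : ∀ {c} s b L → c < s → poch s b L ≐[ c ] 1ₛ
poch≐[]1 s b zero    c<s j j≤c = refl
poch≐[]1 {c} s b (suc L) c<s j j≤c = begin
    poch s b (suc L) j                   ≡⟨ cong (λ f → f j) (poch-cons s b L) ⟩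
    (1-q^ s ⊛ poch (s +ℕ b) b L) j       ≡⟨ ⊛-cong-mod (1-q^≐[]1 s c<s) (poch≐[]1 (s +ℕ b) b L c<s+b) j j≤c ⟩
    (1ₛ ⊛ 1ₛ) j                          ≡⟨ ⊛-identityˡ 1ₛ j ⟩
    1ₛ j                                 ∎
  where
  open ≡-Reasoning
  c<s+b : c < s +ℕ b
  c<s+b = ℕ.<-≤-trans c<s (ℕ.m≤m+n s b)

poch∞≐[]1 : ∀ {c} s b → c < s → poch∞ s b ≐[ c ] 1ₛ
poch∞≐[]1 s b c<s j = poch≐[]1 s b (suc j) c<s j

poch-+≐[] : ∀ {c} s b L d → c < s +ℕ b *ℕ L → poch s b (L +ℕ d) ≐[ c ] poch s b L
poch-+≐[] s b L d c<e j j≤c = begin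
    poch s b (L +ℕ d) j                            ≡⟨ poch-+ s b L d j ⟩
    (poch s b L ⊛ poch (s +ℕ b *ℕ L) b d) j        ≡⟨ ⊛-coeff-cong {poch s b L} {poch s b L} j (λ _ _ → refl) (λ i i≤j → poch≐[]1 (s +ℕ b *ℕ L) b d c<e i (ℕ.≤-trans i≤j j≤c)) ⟩
    (poch s b L ⊛ 1ₛ) j                            ≡⟨ ⊛-identityʳ (poch s b L) j ⟩
    poch s b L j                                   ∎
  where open ≡-Reasoning

n≤s+[1+b]*n : ∀ s b n → n ≤ s +ℕ suc b *ℕ n
n≤s+[1+b]*n s b n = ℕ.≤-trans (ℕ.m≤m+n n (b *ℕ n)) (ℕ.m≤n+m (suc b *ℕ n) s)

-- The factors of index ≥ L are ≡ 1 modulo q^(s + (1+b) L).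
poch∞≐[]poch : ∀ {c} s b L → c < s +ℕ suc b *ℕ L → poch∞ s (suc b) ≐[ c ] poch s (suc b) L
poch∞≐[]poch s b L c<e j j≤c = begin
    poch s (suc b) (suc j) j             ≡⟨ poch-+≐[] s (suc b) (suc j) L (n≤s+[1+b]*n s b (suc j)) j ℕ.≤-refl ⟨
    poch s (suc b) (suc j +ℕ L) j        ≡⟨ cong (λ n → poch s (suc b) n j) (ℕ.+-comm (suc j) L) ⟩
    poch s (suc b) (L +ℕ suc j) j        ≡⟨ poch-+≐[] s (suc b) L (suc j) c<e j j≤c ⟩
    poch s (suc b) L j                   ∎
  where open ≡-Reasoning

poch∞-split : ∀ s b a → poch∞ s (suc b) ≐ poch s (suc b) a ⊛ poch∞ (s +ℕ suc b *ℕ a) (suc b)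
poch∞-split s b a j = begin
    poch∞ s B j                      ≡⟨ poch∞≐[]poch s b (a +ℕ suc j) j<e j ℕ.≤-refl ⟩
    poch s B (a +ℕ suc j) j          ≡⟨ poch-+ s B a (suc j) j ⟩
    (poch s B a ⊛ poch t B (suc j)) j ≡⟨ ⊛-coeff-cong {poch s B a} {poch s B a} j (λ _ _ → refl) tail≐ ⟩
    (poch s B a ⊛ poch∞ t B) j       ∎
  where
  open ≡-Reasoning
  B = suc b
  t = s +ℕ B *ℕ a
  j<e : j < s +ℕ B *ℕ (a +ℕ suc j)
  j<e = ℕ.≤-trans (ℕ.m≤n+m (suc j) a) (n≤s+[1+b]*n s b (a +ℕ suc j))
  tail≐ : poch t B (suc j) ≐[ j ] poch∞ t B
  tail≐ i i≤j = sym (poch∞≐[]poch t b (suc j) (n≤s+[1+b]*n t b (suc j)) i i≤j)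

poch∞-cons : ∀ s b → poch∞ s (suc b) ≐ 1-q^ s ⊛ poch∞ (s +ℕ suc b) (suc b)
poch∞-cons s b = begin
    poch∞ s B                                  ≈⟨ poch∞-split s b 1 ⟩
    poch s B 1 ⊛ poch∞ (s +ℕ B *ℕ 1) B         ≈⟨ ⊛-cong (≡⇒≐ (poch-cons s B 0)) (≡⇒≐ (cong (λ e → poch∞ (s +ℕ e) B) (ℕ.*-identityʳ B))) ⟩
    (1-q^ s ⊛ 1ₛ) ⊛ poch∞ (s +ℕ B) B           ≈⟨ ⊛-congʳ (poch∞ (s +ℕ B) B) (⊛-identityʳ (1-q^ s)) ⟩
    1-q^ s ⊛ poch∞ (s +ℕ B) B                  ∎
  where
  open ≐-Reasoning
  B = suc b

qfac-suc : ∀ k → poch 1 1 (suc k) ≐ poch 1 1 k ⊛ 1-q^ (suc k)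
qfac-suc k = ≐-trans (poch-snoc 1 1 k) (⊛-congˡ (poch 1 1 k) (≡⇒≐ (cong (1-q^_ ∘ suc) (ℕ.*-identityˡ k))))

qfac-+ : ∀ a c → poch 1 1 (a +ℕ c) ≐ poch 1 1 a ⊛ poch (suc a) 1 c
qfac-+ a c = ≐-trans (poch-+ 1 1 a c) (⊛-congˡ (poch 1 1 a) (≡⇒≐ (cong (λ s → poch (suc s) 1 c) (ℕ.*-identityˡ a))))

qfac-⊛-poch∞ : ∀ a → poch 1 1 a ⊛ poch∞ (suc a) 1 ≐ poch∞ 1 1
qfac-⊛-poch∞ a = ≐-sym (≐-trans (poch∞-split 1 0 a) (⊛-congˡ (poch 1 1 a) (≡⇒≐ (cong (λ s → poch∞ (suc s) 1) (ℕ.*-identityˡ a)))))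

qfac≐[]poch∞ : ∀ N → poch 1 1 N ≐[ N ] poch∞ 1 1
qfac≐[]poch∞ N j j≤N = sym (poch∞≐[]poch 1 0 N (s≤s (n≤s+[1+b]*n 0 0 N)) j j≤N)

poch∞₁-cons : ∀ s → poch∞ s 1 ≐ 1-q^ s ⊛ poch∞ (suc s) 1
poch∞₁-cons s = ≐-trans (poch∞-cons s 0) (⊛-congˡ (1-q^ s) (≡⇒≐ (cong (λ e → poch∞ e 1) (ℕ.+-comm s 1))))

-- Telescoping

partialSum : (ℕ → FPS) → ℕ → FPS
partialSum T zero    = 0ₛ
partialSum T (suc K) = T 1 ⊕ partialSum (T ∘ suc) K

sumFrom1≡partialSum : ∀ T N → sumFrom1 T N ≡ partialSum T N N
sumFrom1≡partialSum T N = trans (cong sum (map-applyUpTo id (λ i → T (suc i) N) N)) (sum≡partialSum T N)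
  where
  sum≡partialSum : ∀ T K → sum (applyUpTo (λ i → T (suc i) N) K) ≡ partialSum T K N
  sum≡partialSum T zero    = refl
  sum≡partialSum T (suc K) = cong (λ t → T 1 N + t) (sum≡partialSum (T ∘ suc) K)

partialSum-telescopes : ∀ T G W → (∀ k → T (suc k) ⊛ W ≐ G k ⊖ G (suc k)) →
                        ∀ K → partialSum T K ⊛ W ≐ G 0 ⊖ G K
partialSum-telescopes T G W step zero N = trans (⊛-zeroˡ W N) (sym (ℤ.+-inverseʳ (G 0 N)))
partialSum-telescopes T G W step (suc K) = begin
    (T 1 ⊕ partialSum (T ∘ suc) K) ⊛ W            ≈⟨ ⊛-distribʳ (T 1) (partialSum (T ∘ suc) K) W ⟩
    T 1 ⊛ W ⊕ partialSum (T ∘ suc) K ⊛ W          ≈⟨ ⊕-cong (step 0) (partialSum-telescopes (T ∘ suc) (G ∘ suc) W (step ∘ suc) K) ⟩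
    (G 0 ⊖ G 1) ⊕ (G 1 ⊖ G (suc K))               ≈⟨ cancel (G 0) (G 1) (G (suc K)) ⟩
    G 0 ⊖ G (suc K)                               ∎
  where
  open ≐-Reasoning
  cancel : ∀ a b c → (a ⊖ b) ⊕ (b ⊖ c) ≐ a ⊖ c
  cancel = solve 3 (λ a b c → (a :- b) :+ (b :- c) := a :- c) ≐-refl

module _ (m′ : ℕ) where
  -- m = m′ + 1; D n is the denominator of the n-th summand and G k = Q k P (k+1).
  private
    m : ℕ
    m = suc m′
    E : FPS
    E = poch∞ 1 1
    Q : ℕ → FPS
    Q = poch 1 1
    P : ℕ → FPS
    P n = poch∞ (m *ℕ n) m
    D : ℕ → FPS
    D n = (1-q^ n ⊛ poch (suc n) 1 (m′ *ℕ n)) ⊛ poch∞ (m *ℕ n) 1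
    G : ℕ → FPS
    G k = Q k ⊛ P (suc k)

    P-cons : ∀ n → P n ≐ 1-q^ (m *ℕ n) ⊛ P (suc n)
    P-cons n = ≐-trans (poch∞-cons (m *ℕ n) m′)
      (⊛-congˡ (1-q^ (m *ℕ n)) (≡⇒≐ (cong (λ e → poch∞ e m) (trans (ℕ.+-comm (m *ℕ n) m) (sym (ℕ.*-suc m n))))))

    Q⊛D : ∀ k → Q k ⊛ D (suc k) ≐ 1-q^ (m *ℕ suc k) ⊛ E
    Q⊛D k = begin
        Q k ⊛ ((1-q^ n ⊛ A) ⊛ poch∞ M 1)       ≈⟨ ⊛-congˡ (Q k) (⊛-congˡ (1-q^ n ⊛ A) (poch∞₁-cons M)) ⟩
        Q k ⊛ ((1-q^ n ⊛ A) ⊛ (1-q^ M ⊛ B))    ≈⟨ regroup (Q k) (1-q^ n) A (1-q^ M) B ⟩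
        1-q^ M ⊛ (((Q k ⊛ 1-q^ n) ⊛ A) ⊛ B)    ≈⟨ ⊛-congˡ (1-q^ M) (⊛-congʳ B (⊛-congʳ A (≐-sym (qfac-suc k)))) ⟩
        1-q^ M ⊛ ((Q n ⊛ A) ⊛ B)               ≈⟨ ⊛-congˡ (1-q^ M) (⊛-congʳ B (≐-sym (qfac-+ n (m′ *ℕ n)))) ⟩
        1-q^ M ⊛ (Q M ⊛ B)                     ≈⟨ ⊛-congˡ (1-q^ M) (qfac-⊛-poch∞ M) ⟩
        1-q^ M ⊛ E                             ∎
      where
      open ≐-Reasoning
      n = suc k
      M = m *ℕ n
      A = poch (suc n) 1 (m′ *ℕ n)
      B = poch∞ (suc M) 1
      regroup : ∀ q a b c d → q ⊛ ((a ⊛ b) ⊛ (c ⊛ d)) ≐ c ⊛ (((q ⊛ a) ⊛ b) ⊛ d)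
      regroup = solve 5 (λ q a b c d → q :* ((a :* b) :* (c :* d)) := c :* (((q :* a) :* b) :* d)) ≐-refl

    summand⊛E : ∀ k → summand m (suc k) ⊛ E ≐ G k ⊖ G (suc k)
    summand⊛E k = ⊛-cancelʳ (1-q^ M) (1-q^≐[]1 M (s≤s z≤n) 0 z≤n) (begin
        ((T ⊛ inv (D n)) ⊛ E) ⊛ 1-q^ M           ≈⟨ regroup₁ (T ⊛ inv (D n)) E (1-q^ M) ⟩
        (T ⊛ inv (D n)) ⊛ (1-q^ M ⊛ E)           ≈⟨ ⊛-congˡ (T ⊛ inv (D n)) (Q⊛D k) ⟨
        (T ⊛ inv (D n)) ⊛ (Q k ⊛ D n)            ≈⟨ regroup₂ T (inv (D n)) (Q k) (D n) ⟩
        (T ⊛ Q k) ⊛ (D n ⊛ inv (D n))            ≈⟨ ⊛-congˡ (T ⊛ Q k) (⊛-inverseʳ (D n) D₀≡1) ⟩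
        (T ⊛ Q k) ⊛ 1ₛ                           ≈⟨ ⊛-identityʳ (T ⊛ Q k) ⟩
        T ⊛ Q k                                  ≈⟨ ⊛-congʳ (Q k) (⊛-cong q^n⊛1-q^ (P-cons n)) ⟩
        ((qpow n ⊖ qpow M) ⊛ (1-q^ M ⊛ P (suc n))) ⊛ Q k
          ≈⟨ regroup₃ (qpow n) (qpow M) (Q k) (P (suc n)) ⟩
        (Q k ⊛ (1-q^ M ⊛ P (suc n)) ⊖ (Q k ⊛ 1-q^ n) ⊛ P (suc n)) ⊛ 1-q^ M
          ≈⟨ ⊛-congʳ (1-q^ M) (⊖-cong (⊛-congˡ (Q k) (≐-sym (P-cons n))) (⊛-congʳ (P (suc n)) (≐-sym (qfac-suc k)))) ⟩
        (G k ⊖ G n) ⊛ 1-q^ M                     ∎)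
      where
      open ≐-Reasoning
      n = suc k
      M = m *ℕ n
      T = (qpow n ⊛ 1-q^ (m′ *ℕ n)) ⊛ P n
      D₀≡1 : D n 0 ≡ + 1
      D₀≡1 = ⊛-cong-mod (⊛-cong-mod (1-q^≐[]1 n (s≤s z≤n)) (poch≐[]1 (suc n) 1 (m′ *ℕ n) (s≤s z≤n)))
                        (poch∞≐[]1 M 1 (s≤s z≤n)) 0 z≤n
      q^n⊛1-q^ : qpow n ⊛ 1-q^ (m′ *ℕ n) ≐ qpow n ⊖ qpow M
      q^n⊛1-q^ = ≐-trans (times-1- (qpow n) (qpow (m′ *ℕ n))) (⊖-cong {qpow n} (λ _ → refl) (qpow-+ n (m′ *ℕ n)))
        where
        times-1- : ∀ x z → x ⊛ (1ₛ ⊖ z) ≐ x ⊖ x ⊛ z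
        times-1- = solve 2 (λ x z → x :* (con (+ 1) :- z) := x :- x :* z) ≐-refl
      regroup₁ : ∀ s e f → (s ⊛ e) ⊛ f ≐ s ⊛ (f ⊛ e)
      regroup₁ = solve 3 (λ s e f → (s :* e) :* f := s :* (f :* e)) ≐-refl
      regroup₂ : ∀ t i q d → (t ⊛ i) ⊛ (q ⊛ d) ≐ (t ⊛ q) ⊛ (d ⊛ i)
      regroup₂ = solve 4 (λ t i q d → (t :* i) :* (q :* d) := (t :* q) :* (d :* i)) ≐-refl
      regroup₃ : ∀ x y q r → ((x ⊖ y) ⊛ ((1ₛ ⊖ y) ⊛ r)) ⊛ q ≐ (q ⊛ ((1ₛ ⊖ y) ⊛ r) ⊖ (q ⊛ (1ₛ ⊖ x)) ⊛ r) ⊛ (1ₛ ⊖ y)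
      regroup₃ = solve 4 (λ x y q r → ((x :- y) :* ((con (+ 1) :- y) :* r)) :* q
                                     := (q :* ((con (+ 1) :- y) :* r) :- (q :* (con (+ 1) :- x)) :* r) :* (con (+ 1) :- y)) ≐-refl

    G≐[]E : ∀ N → G N ≐[ N ] E
    G≐[]E N j j≤N = trans (⊛-cong-mod (qfac≐[]poch∞ N) (poch∞≐[]1 (m *ℕ suc N) m (ℕ.m≤m+n (suc N) (m′ *ℕ suc N))) j j≤N)
                          (⊛-identityʳ E j)

  sumFrom1-summand : sumFrom1 (summand m) ≐ const -[1+ 0 ] ⊕ poch∞ m m ⊛ inv E
  sumFrom1-summand N = begin
      sumFrom1 (summand m) N                         ≡⟨ sumFrom1≡partialSum (summand m) N ⟩
      partialSum (summand m) N N                     ≡⟨ ⊛-inv-transpose {partialSum (summand m) N} E E₀≡1 (partialSum-telescopes (summand m) G E summand⊛E N) N ⟩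
      ((G 0 ⊖ G N) ⊛ inv E) N                        ≡⟨ distrib (G 0) (G N) (inv E) N ⟩
      (G 0 ⊛ inv E) N + - (G N ⊛ inv E) N            ≡⟨ cong₂ (λ a b → a + - b) (⊛-congʳ (inv E) G₀≐ N) GN⊛invE ⟩
      (poch∞ m m ⊛ inv E ⊖ 1ₛ) N                     ≡⟨ rearrange (poch∞ m m ⊛ inv E) N ⟩
      (const -[1+ 0 ] ⊕ poch∞ m m ⊛ inv E) N         ∎
    where
    open ≡-Reasoning
    E₀≡1 : E 0 ≡ + 1
    E₀≡1 = poch∞≐[]1 1 1 (s≤s z≤n) 0 z≤n
    G₀≐ : G 0 ≐ poch∞ m m
    G₀≐ = ≐-trans (⊛-identityˡ (P 1)) (≡⇒≐ (cong (λ e → poch∞ e m) (ℕ.*-identityʳ m)))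
    GN⊛invE : (G N ⊛ inv E) N ≡ 1ₛ N
    GN⊛invE = trans (⊛-coeff-cong {g = inv E} {g′ = inv E} N (G≐[]E N) (λ _ _ → refl)) (⊛-inverseʳ E E₀≡1 N)
    distrib : ∀ a b c → (a ⊖ b) ⊛ c ≐ a ⊛ c ⊖ b ⊛ c
    distrib = solve 3 (λ a b c → (a :- b) :* c := a :* c :- b :* c) ≐-refl
    rearrange : ∀ a → a ⊖ 1ₛ ≐ const -[1+ 0 ] ⊕ a
    rearrange = solve 1 (λ a → a :- con (+ 1) := con -[1+ 0 ] :+ a) ≐-refl

-- For m = 1 both sides vanish, so 2 ≤ m is only needed to exclude m = 0.
corollary2 : (m : ℕ) → 2 ≤ m →
    sumFrom1 (summand m) ≐ const -[1+ 0 ] ⊕ poch∞ m m ⊛ inv (poch∞ 1 1)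
corollary2 (suc m′) _ = sumFrom1-summand m′
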